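{- Let $G$ be a finite simple graph with $n$ vertices, and suppose that its subdivision graph $S(G)$ admits an exact doubly dominating set $D$. Then $|D\cap V(G)|\le n-1$. Moreover, $|D\cap V(G)|=n-1$ holds if and only if $G$ is (isomorphic to) the path $P_3$ or the cycle $C_3$.
   Context: All graphs are finite and simple. For a vertex $v$ of a graph $X$, $N_X[v]$ denotes the closed neighborhood of $v$ (the vertex together with its neighbors). An exact doubly dominating set of $X$ is a subset $D\subseteq V(X)$ such that $|N_X[v]\cap D|=2$ for every $v\in V(X)$. The subdivision graph $S(G)$ of $G$ is obtained by replacing every edge $v_iv_j$ of $G$ by a path $v_i z_{ij} v_j$ of order three through a new vertex $z_{ij}$; thus $V(S(G))=V(G)\cup\{z_{ij}: v_iv_j\in E(G)\}$ and $N_{S(G)}(z_{ij})=\{v_i,v_j\}$, and $V(G)\subseteq V(S(G))$. -}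

module Defs where

open import Data.Nat using (ℕ; zero; suc; _+_)
open import Data.Bool using (Bool; true; false; _∧_; _∨_; if_then_else_; T; T?)
import Data.Bool
open import Data.Fin using (Fin; zero; suc; _<_; _<?_)
open import Data.Fin.Properties using (_≟_)
open import Data.List using (List; []; _∷_; _++_; map; concatMap; allFin; length; filter)
open import Data.Product using (Σ; _×_; _,_)
open import Data.Sum using (_⊎_; inj₁; inj₂)
open import Relation.Nullary using (yes; no; does)
open import Relation.Binary.PropositionalEquality using (_≡_)
open import Function.Bundles using (_↔_; Inverse)

record SimpleGraph (n : ℕ) : Set where
  field
    adj    : Fin n → Fin n → Bool
    sym    : ∀ i j → adj i j ≡ adj j i
    irrefl : ∀ i → adj i i ≡ false
open SimpleGraph public

Edge : ∀ {n} → SimpleGraph n → Set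
Edge {n} G = Σ (Fin n) λ i → Σ (Fin n) λ j → i < j × T (adj G i j)

allEdges : ∀ {n} (G : SimpleGraph n) → List (Edge G)
allEdges {n} G = concatMap (λ i → concatMap (λ j → pick i j) (allFin n)) (allFin n)
  where
  pick : (i j : Fin n) → List (Edge G)
  pick i j with i <? j | T? (adj G i j)
  ... | yes i<j | yes e  = (i , j , i<j , e) ∷ []
  ... | _       | _     = []

-- Vertices of the subdivision graph S(G): original vertices v_i (inj₁)
-- and subdivision vertices z_ij, one per edge (inj₂).
SVertex : ∀ {n} → SimpleGraph n → Set
SVertex {n} G = Fin n ⊎ Edge G

allSVertices : ∀ {n} (G : SimpleGraph n) → List (SVertex G)
allSVertices {n} G = map inj₁ (allFin n) ++ map inj₂ (allEdges G)

private
  eqFin : ∀ {n} → Fin n → Fin n → Bool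
  eqFin a b = does (a ≟ b)

-- inClosedNbhd G x y = true  iff  y ∈ N_{S(G)}[x].
-- In S(G) the only edges are v_i – z_ij and v_j – z_ij.
inClosedNbhd : ∀ {n} (G : SimpleGraph n) → SVertex G → SVertex G → Bool
inClosedNbhd G (inj₁ v) (inj₁ w) = eqFin v w
inClosedNbhd G (inj₁ v) (inj₂ (i , j , _)) = eqFin v i ∨ eqFin v j
inClosedNbhd G (inj₂ (i , j , _)) (inj₁ w) = eqFin w i ∨ eqFin w j
inClosedNbhd G (inj₂ (i , j , _)) (inj₂ (k , l , _)) = eqFin i k ∧ eqFin j l

countB : ∀ {A : Set} → (A → Bool) → List A → ℕ
countB p [] = 0
countB p (x ∷ xs) = (if p x then 1 else 0) + countB p xs

closedNbhdCount : ∀ {n} (G : SimpleGraph n) → (SVertex G → Bool) → SVertex G → ℕ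
closedNbhdCount G D x = countB (λ y → inClosedNbhd G x y ∧ D y) (allSVertices G)

IsExactDoublyDominatingS : ∀ {n} (G : SimpleGraph n) → (SVertex G → Bool) → Set
IsExactDoublyDominatingS G D = ∀ x → closedNbhdCount G D x ≡ 2

countOriginal : ∀ {n} (G : SimpleGraph n) → (SVertex G → Bool) → ℕ
countOriginal {n} G D = countB (λ v → D (inj₁ v)) (allFin n)

Isomorphic : ∀ {n m} → SimpleGraph n → SimpleGraph m → Set
Isomorphic {n} {m} G H =
  Σ (Fin n ↔ Fin m) λ f → ∀ i j → adj G i j ≡ adj H (Inverse.to f i) (Inverse.to f j)

P3 : SimpleGraph 3
P3 = record { adj = a ; sym = s ; irrefl = r }
  where
  a : Fin 3 → Fin 3 → Bool
  a zero (suc zero) = true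
  a (suc zero) zero = true
  a (suc zero) (suc (suc zero)) = true
  a (suc (suc zero)) (suc zero) = true
  a _ _ = false
  s : ∀ i j → a i j ≡ a j i
  s zero zero = _≡_.refl
  s zero (suc zero) = _≡_.refl
  s zero (suc (suc zero)) = _≡_.refl
  s (suc zero) zero = _≡_.refl
  s (suc zero) (suc zero) = _≡_.refl
  s (suc zero) (suc (suc zero)) = _≡_.refl
  s (suc (suc zero)) zero = _≡_.refl
  s (suc (suc zero)) (suc zero) = _≡_.refl
  s (suc (suc zero)) (suc (suc zero)) = _≡_.refl
  r : ∀ i → a i i ≡ false
  r zero = _≡_.refl
  r (suc zero) = _≡_.refl
  r (suc (suc zero)) = _≡_.refl

C3 : SimpleGraph 3
C3 = record { adj = λ i j → Data.Bool.not (eqFin i j) ; sym = s ; irrefl = r }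
  where
  s : ∀ (i j : Fin 3) → Data.Bool.not (eqFin i j) ≡ Data.Bool.not (eqFin j i)
  s zero zero = _≡_.refl
  s zero (suc zero) = _≡_.refl
  s zero (suc (suc zero)) = _≡_.refl
  s (suc zero) zero = _≡_.refl
  s (suc zero) (suc zero) = _≡_.refl
  s (suc zero) (suc (suc zero)) = _≡_.refl
  s (suc (suc zero)) zero = _≡_.refl
  s (suc (suc zero)) (suc zero) = _≡_.refl
  s (suc (suc zero)) (suc (suc zero)) = _≡_.refl
  r : ∀ (i : Fin 3) → Data.Bool.not (eqFin i i) ≡ false
  r zero = _≡_.refl
  r (suc zero) = _≡_.refl
  r (suc (suc zero)) = _≡_.refl

-- Write A = D ∩ V(G) and B = V(G) ∖ A. The closed neighbourhood of a subdivision
-- vertex z_ij is {z_ij, v_i, v_j}, so exactness forces z_ij ∈ D iff exactly one of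
-- v_i, v_j lies in A. The D-vertices around v ∈ V(G) are therefore v itself (if
-- v ∈ A) and the z_ij of the A–B edges at v: every vertex of A has exactly one
-- neighbour in B and every vertex of B exactly two in A. Counting the A–B edges
-- from both sides gives |A| = 2|B|, hence n = 3|B|, |A| ≤ n − 1 as n ≥ 1, and
-- equality means |B| = 1 and n = 3 with the vertex of B adjacent to both vertices
-- of A, that is, G is P₃ or C₃.

module Submission where

open import Defs hiding (sym)
open import Data.Nat using (ℕ; zero; suc; _+_; _*_; _≤_; _∸_)
open import Data.Nat.Properties
  using ( +-*-semiring; +-assoc; +-comm; +-identityʳ; +-suc; suc-injective
        ; +-cancelˡ-≡; *-cancelˡ-≡; m∸n+n≡m; m≤m+n)
open import Data.Bool using (Bool; true; false; _∧_; _∨_; not; _xor_; if_then_else_; T?)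
open import Data.Bool.Properties using (T-irrelevant; ∧-zeroʳ; xor-comm)
import Data.Bool.Properties as Boolₚ
open import Data.Fin using (Fin; zero; suc; _<?_)
open import Data.Fin.Patterns using (0F; 1F; 2F)
open import Data.Fin.Properties using (_≟_; all?; <-irrelevant; <-irrefl; <-asym; <-cmp)
open import Data.Fin.Permutation as Perm using (Permutation′; _⟨$⟩ʳ_; transpose; ↔⇒≡)
open import Data.List using (List; []; _∷_; _++_; map; concatMap; allFin; tabulate)
open import Data.Product using (Σ; _×_; _,_; proj₁; proj₂)
open import Data.Sum as Sum using (_⊎_; inj₁; inj₂)
open import Data.Empty using (⊥-elim)
open import Function using (id; _∘_)
open import Function.Bundles using (_⇔_; mk⇔)
open import Relation.Binary using (tri<; tri≈; tri>)
open import Relation.Binary.PropositionalEquality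
  using (_≡_; _≢_; refl; sym; trans; cong; cong₂; subst; module ≡-Reasoning)
open import Relation.Nullary using (yes; no; does)
open import Relation.Nullary.Decidable using (dec-true; dec-false; True; toWitness)
open import Algebra.Properties.Semiring.Sum +-*-semiring
  using (sum-syntax; sum-cong-≗; ∑-distrib-+; ∑-comm; *-distribˡ-sum; sum-replicate-zero)

𝟙 : Bool → ℕ
𝟙 b = if b then 1 else 0

_==_ : ∀ {n} → Fin n → Fin n → Bool
i == j = does (i ≟ j)

_<ᵇ_ : ∀ {n} → Fin n → Fin n → Bool
i <ᵇ j = does (i <? j)

==-sym : ∀ {n} (i j : Fin n) → i == j ≡ j == i
==-sym i j with i ≟ j | j ≟ i
... | yes _    | yes _    = refl
... | no _     | no _     = refl
... | yes i≡j  | no j≢i   = ⊥-elim (j≢i (sym i≡j))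
... | no i≢j   | yes j≡i  = ⊥-elim (i≢j (sym j≡i))

module _ {A : Set} (p : A → Bool) where

  countB-++ : ∀ xs ys → countB p (xs ++ ys) ≡ countB p xs + countB p ys
  countB-++ []       ys = refl
  countB-++ (x ∷ xs) ys = trans (cong (𝟙 (p x) +_) (countB-++ xs ys)) (sym (+-assoc (𝟙 (p x)) _ _))

  countB-map : ∀ {B : Set} (f : B → A) xs → countB p (map f xs) ≡ countB (λ x → p (f x)) xs
  countB-map f []       = refl
  countB-map f (x ∷ xs) = cong (𝟙 (p (f x)) +_) (countB-map f xs)

  countB-tabulate : ∀ {n} (f : Fin n → A) → countB p (tabulate f) ≡ ∑[ i < n ] 𝟙 (p (f i))
  countB-tabulate {zero}  f = refl
  countB-tabulate {suc n} f = cong (𝟙 (p (f zero)) +_) (countB-tabulate (λ i → f (suc i)))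

  countB-concatMap-tabulate : ∀ {B : Set} {n} (g : B → List A) (f : Fin n → B) →
    countB p (concatMap g (tabulate f)) ≡ ∑[ i < n ] countB p (g (f i))
  countB-concatMap-tabulate {n = zero}  g f = refl
  countB-concatMap-tabulate {n = suc n} g f =
    trans (countB-++ (g (f zero)) _)
          (cong (countB p (g (f zero)) +_) (countB-concatMap-tabulate g (λ i → f (suc i))))

∑-select : ∀ {n} (v : Fin n) (b : Fin n → Bool) → ∑[ u < n ] 𝟙 (v == u ∧ b u) ≡ 𝟙 (b v)
∑-select {suc n} zero    b = trans (cong (𝟙 (b zero) +_) (sum-replicate-zero n)) (+-identityʳ _)
∑-select {suc n} (suc v) b = ∑-select v (λ u → b (suc u))

∑∑-select : ∀ {n} (k l : Fin n) (b : Fin n → Fin n → Bool) →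
  ∑[ i < n ] ∑[ j < n ] 𝟙 (k == i ∧ (l == j ∧ b i j)) ≡ 𝟙 (b k l)
∑∑-select {n} k l b = begin
  ∑[ i < n ] ∑[ j < n ] 𝟙 (k == i ∧ (l == j ∧ b i j))
    ≡⟨ sum-cong-≗ (λ i → sum-cong-≗ (λ j → cong 𝟙 (∧-swap (k == i) (l == j) (b i j)))) ⟩
  ∑[ i < n ] ∑[ j < n ] 𝟙 (l == j ∧ (k == i ∧ b i j))
    ≡⟨ sum-cong-≗ (λ i → ∑-select l (λ j → k == i ∧ b i j)) ⟩
  ∑[ i < n ] 𝟙 (k == i ∧ b i l)
    ≡⟨ ∑-select k (λ i → b i l) ⟩
  𝟙 (b k l) ∎
  where
  open ≡-Reasoning
  ∧-swap : ∀ x y z → x ∧ (y ∧ z) ≡ y ∧ (x ∧ z)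
  ∧-swap true  y z = refl
  ∧-swap false y z = sym (∧-zeroʳ y)

𝟙-∨-∧ : ∀ x y z → x ∧ y ∧ z ≡ false → 𝟙 ((x ∨ y) ∧ z) ≡ 𝟙 (x ∧ z) + 𝟙 (y ∧ z)
𝟙-∨-∧ true  false z _ = sym (+-identityʳ (𝟙 z))
𝟙-∨-∧ false y     z _ = refl
𝟙-∨-∧ true  true  z disjoint rewrite disjoint = refl

∑-𝟙≡0⇒false : ∀ {n} (p : Fin n → Bool) → ∑[ i < n ] 𝟙 (p i) ≡ 0 → ∀ j → p j ≡ false
∑-𝟙≡0⇒false p none zero    with p zero
... | false = refl
∑-𝟙≡0⇒false p none (suc j) with p zero
... | false = ∑-𝟙≡0⇒false (λ i → p (suc i)) none j

∑-𝟙≡1⇒unique : ∀ {n} (p : Fin n → Bool) → ∑[ i < n ] 𝟙 (p i) ≡ 1 →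
  Σ (Fin n) λ i → p i ≡ true × (∀ j → p j ≡ true → j ≡ i)
∑-𝟙≡1⇒unique {suc n} p one with p zero in p₀
... | true  = zero , p₀ , only
  where
  only : ∀ j → p j ≡ true → j ≡ zero
  only zero    _   = refl
  only (suc j) pⱼ with () ← trans (sym pⱼ) (∑-𝟙≡0⇒false (λ i → p (suc i)) (suc-injective one) j)
... | false with ∑-𝟙≡1⇒unique (λ i → p (suc i)) one
...   | i , pᵢ , only = suc i , pᵢ , only′
  where
  only′ : ∀ j → p j ≡ true → j ≡ suc i
  only′ zero    p₀′ with () ← trans (sym p₀′) p₀
  only′ (suc j) pⱼ = cong suc (only j pⱼ)

module _ {n} (G : SimpleGraph n) where

  -- allEdges concatenates one list per ordered pair, built by a helper local to Defs;
  -- unification against the definition of allEdges recovers that helper.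
  private
    edgeCells : Σ (Fin n → Fin n → List (Edge G)) λ cell →
      allEdges G ≡ concatMap (λ i → concatMap (cell i) (allFin n)) (allFin n)
    edgeCells = _ , refl

    countB-cell : (p : Edge G → Bool) (h : Fin n → Fin n → Bool) →
      (∀ i j i<j e → p (i , j , i<j , e) ≡ h i j) →
      ∀ i j → countB p (proj₁ edgeCells i j) ≡ 𝟙 ((i <ᵇ j ∧ adj G i j) ∧ h i j)
    countB-cell p h p≗h i j with i <? j | T? (adj G i j)
    ... | yes i<j | yes e
      rewrite dec-true (i <? j) i<j | dec-true (T? (adj G i j)) e | p≗h i j i<j e = +-identityʳ _
    ... | yes i<j | no ¬e rewrite dec-true (i <? j) i<j | dec-false (T? (adj G i j)) ¬e = refl
    ... | no ¬i<j | _     rewrite dec-false (i <? j) ¬i<j = refl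

  countB-allEdges : (p : Edge G → Bool) (h : Fin n → Fin n → Bool) →
    (∀ i j i<j e → p (i , j , i<j , e) ≡ h i j) →
    countB p (allEdges G) ≡ ∑[ i < n ] ∑[ j < n ] 𝟙 ((i <ᵇ j ∧ adj G i j) ∧ h i j)
  countB-allEdges p h p≗h = begin
    countB p (concatMap (λ i → concatMap (cell i) (allFin n)) (allFin n))
      ≡⟨ countB-concatMap-tabulate p (λ i → concatMap (cell i) (allFin n)) id ⟩
    ∑[ i < n ] countB p (concatMap (cell i) (allFin n))
      ≡⟨ sum-cong-≗ (λ i → countB-concatMap-tabulate p (cell i) id) ⟩
    ∑[ i < n ] ∑[ j < n ] countB p (cell i j)
      ≡⟨ sum-cong-≗ (λ i → sum-cong-≗ (countB-cell p h p≗h i)) ⟩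
    ∑[ i < n ] ∑[ j < n ] 𝟙 ((i <ᵇ j ∧ adj G i j) ∧ h i j) ∎
    where
    open ≡-Reasoning
    cell = proj₁ edgeCells

  ∑-edgesAt≡degree : (r : Fin n → Fin n → Bool) → (∀ i j → r i j ≡ r j i) → ∀ v →
    ∑[ i < n ] ∑[ j < n ] 𝟙 ((i <ᵇ j ∧ adj G i j) ∧ ((v == i ∨ v == j) ∧ r i j))
      ≡ ∑[ u < n ] 𝟙 (adj G v u ∧ r v u)
  ∑-edgesAt≡degree r r-sym v = begin
    ∑[ i < n ] ∑[ j < n ] 𝟙 ((i <ᵇ j ∧ adj G i j) ∧ ((v == i ∨ v == j) ∧ r i j))
      ≡⟨ sum-cong-≗ (λ i → sum-cong-≗ (split i)) ⟩
    ∑[ i < n ] ∑[ j < n ] (𝟙 (v == i ∧ out i j) + 𝟙 (v == j ∧ out i j))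
      ≡⟨ sum-cong-≗ (λ i → ∑-distrib-+ (λ j → 𝟙 (v == i ∧ out i j)) _) ⟩
    ∑[ i < n ] (∑[ j < n ] 𝟙 (v == i ∧ out i j) + ∑[ j < n ] 𝟙 (v == j ∧ out i j))
      ≡⟨ ∑-distrib-+ (λ i → ∑[ j < n ] 𝟙 (v == i ∧ out i j)) _ ⟩
    ∑[ i < n ] ∑[ j < n ] 𝟙 (v == i ∧ out i j) + ∑[ i < n ] ∑[ j < n ] 𝟙 (v == j ∧ out i j)
      ≡⟨ cong₂ _+_ (trans (∑-comm (λ i j → 𝟙 (v == i ∧ out i j)))
                          (sum-cong-≗ (λ j → ∑-select v (λ i → out i j))))
                   (sum-cong-≗ (λ i → ∑-select v (out i))) ⟩
    ∑[ u < n ] 𝟙 (out v u) + ∑[ u < n ] 𝟙 (out u v)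
      ≡⟨ sym (∑-distrib-+ (λ u → 𝟙 (out v u)) _) ⟩
    ∑[ u < n ] (𝟙 (out v u) + 𝟙 (out u v))
      ≡⟨ sum-cong-≗ merge ⟩
    ∑[ u < n ] 𝟙 (adj G v u ∧ r v u) ∎
    where
    open ≡-Reasoning
    out : Fin n → Fin n → Bool
    out i j = (i <ᵇ j ∧ adj G i j) ∧ r i j

    split : ∀ i j → 𝟙 ((i <ᵇ j ∧ adj G i j) ∧ ((v == i ∨ v == j) ∧ r i j))
                  ≡ 𝟙 (v == i ∧ out i j) + 𝟙 (v == j ∧ out i j)
    split i j with v ≟ i | v ≟ j
    ... | yes refl | yes refl rewrite dec-false (v <? v) (<-irrefl refl) = refl
    ... | yes refl | no _     = sym (+-identityʳ _)
    ... | no _     | yes refl = refl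
    ... | no _     | no _     = cong 𝟙 (∧-zeroʳ _)

    merge : ∀ u → 𝟙 (out v u) + 𝟙 (out u v) ≡ 𝟙 (adj G v u ∧ r v u)
    merge u with <-cmp v u
    ... | tri< v<u _ _ rewrite dec-true (v <? u) v<u | dec-false (u <? v) (<-asym v<u) = +-identityʳ _
    ... | tri≈ _ refl _ rewrite dec-false (v <? v) (<-irrefl refl) | irrefl G v = refl
    ... | tri> _ _ u<v rewrite dec-false (v <? u) (<-asym u<v) | dec-true (u <? v) u<v
                             | SimpleGraph.sym G u v | r-sym u v = refl

  crossDegree : (Fin n → Bool) → Fin n → ℕ
  crossDegree a v = ∑[ u < n ] 𝟙 (adj G v u ∧ (a v xor a u))

  ∑-crossDegree-inside≡outside : (a : Fin n → Bool) →
    ∑[ v < n ] (𝟙 (a v) * crossDegree a v) ≡ ∑[ v < n ] (𝟙 (not (a v)) * crossDegree a v)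
  ∑-crossDegree-inside≡outside a = begin
    ∑[ v < n ] (𝟙 (a v) * crossDegree a v)
      ≡⟨ sum-cong-≗ (λ v → *-distribˡ-sum (𝟙 (a v)) (cross v)) ⟩
    ∑[ v < n ] ∑[ u < n ] (𝟙 (a v) * 𝟙 (adj G v u ∧ (a v xor a u)))
      ≡⟨ sum-cong-≗ (λ v → sum-cong-≗ (λ u → reverse v u)) ⟩
    ∑[ v < n ] ∑[ u < n ] (𝟙 (not (a u)) * 𝟙 (adj G u v ∧ (a u xor a v)))
      ≡⟨ ∑-comm (λ v u → 𝟙 (not (a u)) * 𝟙 (adj G u v ∧ (a u xor a v))) ⟩
    ∑[ u < n ] ∑[ v < n ] (𝟙 (not (a u)) * 𝟙 (adj G u v ∧ (a u xor a v)))
      ≡⟨ sum-cong-≗ (λ u → sym (*-distribˡ-sum (𝟙 (not (a u))) (cross u))) ⟩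
    ∑[ u < n ] (𝟙 (not (a u)) * crossDegree a u) ∎
    where
    open ≡-Reasoning
    cross : Fin n → Fin n → ℕ
    cross v u = 𝟙 (adj G v u ∧ (a v xor a u))
    reverse : ∀ v u → 𝟙 (a v) * cross v u ≡ 𝟙 (not (a u)) * cross u v
    reverse v u rewrite SimpleGraph.sym G v u with a v | a u | adj G u v
    ... | true  | false | _     = refl
    ... | false | true  | _     = refl
    ... | true  | true  | true  = refl
    ... | true  | true  | false = refl
    ... | false | false | true  = refl
    ... | false | false | false = refl

module _ {n} (G : SimpleGraph n) (D : SVertex G → Bool) where

  closedNbhdCount-split : ∀ x → closedNbhdCount G D x ≡
    ∑[ w < n ] 𝟙 (inClosedNbhd G x (inj₁ w) ∧ D (inj₁ w))
      + countB (λ e → inClosedNbhd G x (inj₂ e) ∧ D (inj₂ e)) (allEdges G)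
  closedNbhdCount-split x =
    trans (countB-++ p (map inj₁ (allFin n)) (map inj₂ (allEdges G)))
          (cong₂ _+_ (trans (countB-map p inj₁ (allFin n)) (countB-tabulate (λ w → p (inj₁ w)) id))
                     (countB-map p inj₂ (allEdges G)))
    where
    p : SVertex G → Bool
    p y = inClosedNbhd G x y ∧ D y

  closedNbhdCount-subdivisionVertex : ∀ k l k<l t →
    closedNbhdCount G D (inj₂ (k , l , k<l , t))
      ≡ 𝟙 (D (inj₁ k)) + 𝟙 (D (inj₁ l)) + 𝟙 (D (inj₂ (k , l , k<l , t)))
  closedNbhdCount-subdivisionVertex k l k<l t = begin
    closedNbhdCount G D (inj₂ z)
      ≡⟨ closedNbhdCount-split (inj₂ z) ⟩
    ∑[ w < n ] 𝟙 ((w == k ∨ w == l) ∧ D (inj₁ w))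
      + countB (λ e → inClosedNbhd G (inj₂ z) (inj₂ e) ∧ D (inj₂ e)) (allEdges G)
      ≡⟨ cong₂ _+_ endpoints (countB-allEdges G _ (λ i j → (k == i ∧ l == j) ∧ D (inj₂ z)) sameEdge) ⟩
    𝟙 (D (inj₁ k)) + 𝟙 (D (inj₁ l))
      + ∑[ i < n ] ∑[ j < n ] 𝟙 ((i <ᵇ j ∧ adj G i j) ∧ ((k == i ∧ l == j) ∧ D (inj₂ z)))
      ≡⟨ cong (𝟙 (D (inj₁ k)) + 𝟙 (D (inj₁ l)) +_) (trans
           (sum-cong-≗ (λ i → sum-cong-≗ (λ j →
              cong 𝟙 (∧-rotate (i <ᵇ j ∧ adj G i j) (k == i) (l == j) (D (inj₂ z))))))
           (∑∑-select k l (λ i j → (i <ᵇ j ∧ adj G i j) ∧ D (inj₂ z)))) ⟩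
    𝟙 (D (inj₁ k)) + 𝟙 (D (inj₁ l)) + 𝟙 ((k <ᵇ l ∧ adj G k l) ∧ D (inj₂ z))
      ≡⟨ cong (λ b → 𝟙 (D (inj₁ k)) + 𝟙 (D (inj₁ l)) + 𝟙 (b ∧ D (inj₂ z)))
              (cong₂ _∧_ (dec-true (k <? l) k<l) (dec-true (T? (adj G k l)) t)) ⟩
    𝟙 (D (inj₁ k)) + 𝟙 (D (inj₁ l)) + 𝟙 (D (inj₂ z)) ∎
    where
    open ≡-Reasoning
    z : Edge G
    z = k , l , k<l , t

    endpoints : ∑[ w < n ] 𝟙 ((w == k ∨ w == l) ∧ D (inj₁ w)) ≡ 𝟙 (D (inj₁ k)) + 𝟙 (D (inj₁ l))
    endpoints = begin
      ∑[ w < n ] 𝟙 ((w == k ∨ w == l) ∧ D (inj₁ w))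
        ≡⟨ sum-cong-≗ (λ w →
             trans (cong (λ b → 𝟙 (b ∧ D (inj₁ w))) (cong₂ _∨_ (==-sym w k) (==-sym w l)))
                   (𝟙-∨-∧ (k == w) (l == w) (D (inj₁ w)) (distinct w))) ⟩
      ∑[ w < n ] (𝟙 (k == w ∧ D (inj₁ w)) + 𝟙 (l == w ∧ D (inj₁ w)))
        ≡⟨ ∑-distrib-+ (λ w → 𝟙 (k == w ∧ D (inj₁ w))) _ ⟩
      ∑[ w < n ] 𝟙 (k == w ∧ D (inj₁ w)) + ∑[ w < n ] 𝟙 (l == w ∧ D (inj₁ w))
        ≡⟨ cong₂ _+_ (∑-select k (λ w → D (inj₁ w))) (∑-select l (λ w → D (inj₁ w))) ⟩
      𝟙 (D (inj₁ k)) + 𝟙 (D (inj₁ l)) ∎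
      where
      distinct : ∀ w → k == w ∧ l == w ∧ D (inj₁ w) ≡ false
      distinct w with k ≟ w | l ≟ w
      ... | yes refl | yes refl = ⊥-elim (<-irrefl refl k<l)
      ... | yes _    | no _     = refl
      ... | no _     | _        = refl

    sameEdge : ∀ i j i<j e → inClosedNbhd G (inj₂ z) (inj₂ (i , j , i<j , e)) ∧ D (inj₂ (i , j , i<j , e))
                               ≡ (k == i ∧ l == j) ∧ D (inj₂ z)
    sameEdge i j i<j e with k ≟ i | l ≟ j
    ... | yes refl | yes refl rewrite <-irrelevant i<j k<l | T-irrelevant e t = refl
    ... | yes _    | no _     = refl
    ... | no _     | _        = refl

    ∧-rotate : ∀ e x y c → e ∧ ((x ∧ y) ∧ c) ≡ x ∧ (y ∧ (e ∧ c))
    ∧-rotate e true  true  c = refl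
    ∧-rotate e true  false c = ∧-zeroʳ e
    ∧-rotate e false y     c = ∧-zeroʳ e

  closedNbhdCount-originalVertex :
    (∀ k l k<l t → D (inj₂ (k , l , k<l , t)) ≡ D (inj₁ k) xor D (inj₁ l)) → ∀ v →
    closedNbhdCount G D (inj₁ v) ≡ 𝟙 (D (inj₁ v)) + crossDegree G (λ w → D (inj₁ w)) v
  closedNbhdCount-originalVertex edge-xor v = begin
    closedNbhdCount G D (inj₁ v)
      ≡⟨ closedNbhdCount-split (inj₁ v) ⟩
    ∑[ w < n ] 𝟙 (v == w ∧ D (inj₁ w))
      + countB (λ e → inClosedNbhd G (inj₁ v) (inj₂ e) ∧ D (inj₂ e)) (allEdges G)
      ≡⟨ cong₂ _+_ (∑-select v (λ w → D (inj₁ w))) (countB-allEdges G _ incident incident-xor) ⟩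
    𝟙 (D (inj₁ v)) + ∑[ i < n ] ∑[ j < n ] 𝟙 ((i <ᵇ j ∧ adj G i j) ∧ incident i j)
      ≡⟨ cong (𝟙 (D (inj₁ v)) +_) (∑-edgesAt≡degree G cut cut-sym v) ⟩
    𝟙 (D (inj₁ v)) + crossDegree G (λ w → D (inj₁ w)) v ∎
    where
    open ≡-Reasoning
    cut : Fin n → Fin n → Bool
    cut i j = D (inj₁ i) xor D (inj₁ j)

    cut-sym : ∀ i j → cut i j ≡ cut j i
    cut-sym i j = xor-comm (D (inj₁ i)) (D (inj₁ j))

    incident : Fin n → Fin n → Bool
    incident i j = (v == i ∨ v == j) ∧ cut i j

    incident-xor : ∀ i j i<j e → (v == i ∨ v == j) ∧ D (inj₂ (i , j , i<j , e)) ≡ incident i j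
    incident-xor i j i<j e = cong ((v == i ∨ v == j) ∧_) (edge-xor i j i<j e)

module _ {a b n : ℕ} (a+b≡n : a + b ≡ n) where

  a≡n∸1⇒b≡1 : 1 ≤ n → a ≡ n ∸ 1 → b ≡ 1
  a≡n∸1⇒b≡1 1≤n a≡n∸1 =
    +-cancelˡ-≡ a b 1 (trans a+b≡n (sym (trans (cong (_+ 1) a≡n∸1) (m∸n+n≡m 1≤n))))

  module _ (a≡2*b : a ≡ 2 * b) where

    b≡1⇒n≡3 : b ≡ 1 → n ≡ 3
    b≡1⇒n≡3 b≡1 = trans (sym a+b≡n) (cong₂ _+_ (trans a≡2*b (cong (2 *_) b≡1)) b≡1)

    n≡3⇒a≡n∸1 : n ≡ 3 → a ≡ n ∸ 1
    n≡3⇒a≡n∸1 n≡3 = trans a≡2*b (trans (cong (2 *_) b≡1) (sym (cong (_∸ 1) n≡3)))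
      where
      b≡1 : b ≡ 1
      b≡1 = *-cancelˡ-≡ b 1 3 (trans (cong (b +_) (sym a≡2*b)) (trans (+-comm b a) (trans a+b≡n n≡3)))

a≤n∸1 : ∀ {a b n} → a + b ≡ n → a ≡ 2 * b → 1 ≤ n → a ≤ n ∸ 1
a≤n∸1 {b = zero}  refl refl ()
a≤n∸1 {a} {suc b} refl _    _ rewrite +-suc a b = m≤m+n a b

adj-flip : ∀ {n} (G : SimpleGraph n) {i j} → adj G i j ≡ true → adj G j i ≡ true
adj-flip G {i} {j} = trans (SimpleGraph.sym G j i)

triangleTable : Bool → Bool → Bool → Fin 3 → Fin 3 → Bool
triangleTable e₀₁ e₀₂ e₁₂ = table
  where
  table : Fin 3 → Fin 3 → Bool
  table 0F 1F = e₀₁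
  table 1F 0F = e₀₁
  table 0F 2F = e₀₂
  table 2F 0F = e₀₂
  table 1F 2F = e₁₂
  table 2F 1F = e₁₂
  table _  _  = false

adj≡triangleTable : (G : SimpleGraph 3) →
  ∀ i j → adj G i j ≡ triangleTable (adj G 0F 1F) (adj G 0F 2F) (adj G 1F 2F) i j
adj≡triangleTable G 0F 0F = irrefl G 0F
adj≡triangleTable G 0F 1F = refl
adj≡triangleTable G 0F 2F = refl
adj≡triangleTable G 1F 0F = SimpleGraph.sym G 1F 0F
adj≡triangleTable G 1F 1F = irrefl G 1F
adj≡triangleTable G 1F 2F = refl
adj≡triangleTable G 2F 0F = SimpleGraph.sym G 2F 0F
adj≡triangleTable G 2F 1F = SimpleGraph.sym G 2F 1F
adj≡triangleTable G 2F 2F = irrefl G 2F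

-- The implicit proof is found by evaluating the nine comparisons.
isomorphic-byTable : ∀ {e₀₁ e₀₂ e₁₂} (G H : SimpleGraph 3) (σ : Permutation′ 3) →
  adj G 0F 1F ≡ e₀₁ → adj G 0F 2F ≡ e₀₂ → adj G 1F 2F ≡ e₁₂ →
  {True (all? λ i → all? λ j →
           triangleTable e₀₁ e₀₂ e₁₂ i j Boolₚ.≟ adj H (σ ⟨$⟩ʳ i) (σ ⟨$⟩ʳ j))} →
  Isomorphic G H
isomorphic-byTable G H σ refl refl refl {agrees} =
  σ , λ i j → trans (adj≡triangleTable G i j) (toWitness agrees i j)

hub⇒P3⊎C3 : ∀ {n} (G : SimpleGraph n) → n ≡ 3 → (c : Fin n) → (∀ v → v ≢ c → adj G c v ≡ true) →
  Isomorphic G P3 ⊎ Isomorphic G C3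
hub⇒P3⊎C3 G refl 0F hub with adj G 1F 2F in e₁₂
... | true  = inj₂ (isomorphic-byTable G C3 Perm.id (hub 1F λ ()) (hub 2F λ ()) e₁₂)
... | false = inj₁ (isomorphic-byTable G P3 (transpose 0F 1F) (hub 1F λ ()) (hub 2F λ ()) e₁₂)
hub⇒P3⊎C3 G refl 1F hub with adj G 0F 2F in e₀₂
... | true  = inj₂ (isomorphic-byTable G C3 Perm.id (adj-flip G (hub 0F λ ())) e₀₂ (hub 2F λ ()))
... | false = inj₁ (isomorphic-byTable G P3 Perm.id (adj-flip G (hub 0F λ ())) e₀₂ (hub 2F λ ()))
hub⇒P3⊎C3 G refl 2F hub with adj G 0F 1F in e₀₁
... | true  = inj₂ (isomorphic-byTable G C3 Perm.id
                      e₀₁ (adj-flip G (hub 0F λ ())) (adj-flip G (hub 1F λ ())))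
... | false = inj₁ (isomorphic-byTable G P3 (transpose 1F 2F)
                      e₀₁ (adj-flip G (hub 0F λ ())) (adj-flip G (hub 1F λ ())))

module ExactDoubleDomination {n} (G : SimpleGraph n) (D : SVertex G → Bool)
                             (exact : IsExactDoublyDominatingS G D) where

  inside : Fin n → Bool
  inside v = D (inj₁ v)

  insideCount outsideCount : ℕ
  insideCount  = ∑[ v < n ] 𝟙 (inside v)
  outsideCount = ∑[ v < n ] 𝟙 (not (inside v))

  subdivisionVertex≡xor : ∀ k l k<l t → D (inj₂ (k , l , k<l , t)) ≡ inside k xor inside l
  subdivisionVertex≡xor k l k<l t =
    sum≡2 (inside k) (inside l) _
      (trans (sym (closedNbhdCount-subdivisionVertex G D k l k<l t)) (exact (inj₂ (k , l , k<l , t))))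
    where
    sum≡2 : ∀ x y z → 𝟙 x + 𝟙 y + 𝟙 z ≡ 2 → z ≡ x xor y
    sum≡2 true  true  false _ = refl
    sum≡2 true  false true  _ = refl
    sum≡2 false true  true  _ = refl
    sum≡2 false false true  ()
    sum≡2 false false false ()
    sum≡2 true  true  true  ()
    sum≡2 true  false false ()
    sum≡2 false true  false ()

  inside+crossDegree≡2 : ∀ v → 𝟙 (inside v) + crossDegree G inside v ≡ 2
  inside+crossDegree≡2 v =
    trans (sym (closedNbhdCount-originalVertex G D subdivisionVertex≡xor v)) (exact (inj₁ v))

  countOriginal≡insideCount : countOriginal G D ≡ insideCount
  countOriginal≡insideCount = countB-tabulate inside id

  insideCount≡2*outsideCount : insideCount ≡ 2 * outsideCount
  insideCount≡2*outsideCount = begin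
    ∑[ v < n ] 𝟙 (inside v)
      ≡⟨ sum-cong-≗ (λ v → sym (inside* (inside v) (inside+crossDegree≡2 v))) ⟩
    ∑[ v < n ] (𝟙 (inside v) * crossDegree G inside v)
      ≡⟨ ∑-crossDegree-inside≡outside G inside ⟩
    ∑[ v < n ] (𝟙 (not (inside v)) * crossDegree G inside v)
      ≡⟨ sum-cong-≗ (λ v → outside* (inside v) (inside+crossDegree≡2 v)) ⟩
    ∑[ v < n ] (2 * 𝟙 (not (inside v)))
      ≡⟨ sym (*-distribˡ-sum 2 (λ v → 𝟙 (not (inside v)))) ⟩
    2 * outsideCount ∎
    where
    open ≡-Reasoning
    inside* : ∀ b {c} → 𝟙 b + c ≡ 2 → 𝟙 b * c ≡ 𝟙 b
    inside* true  {c} b+c≡2 = trans (+-identityʳ c) (suc-injective b+c≡2)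
    inside* false     _     = refl
    outside* : ∀ b {c} → 𝟙 b + c ≡ 2 → 𝟙 (not b) * c ≡ 2 * 𝟙 (not b)
    outside* true      _     = refl
    outside* false {c} b+c≡2 = trans (+-identityʳ c) b+c≡2

  insideCount+outsideCount≡n : insideCount + outsideCount ≡ n
  insideCount+outsideCount≡n =
    trans (sym (∑-distrib-+ (λ v → 𝟙 (inside v)) (λ v → 𝟙 (not (inside v)))))
          (trans (sum-cong-≗ (λ v → 𝟙+𝟙not≡1 (inside v))) (∑1≡n n))
    where
    𝟙+𝟙not≡1 : ∀ b → 𝟙 b + 𝟙 (not b) ≡ 1
    𝟙+𝟙not≡1 true  = refl
    𝟙+𝟙not≡1 false = refl
    ∑1≡n : ∀ m → ∑[ i < m ] 1 ≡ m
    ∑1≡n zero    = refl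
    ∑1≡n (suc m) = cong suc (∑1≡n m)

  crossDegree≡1 : ∀ v → inside v ≡ true → crossDegree G inside v ≡ 1
  crossDegree≡1 v v-inside =
    suc-injective (subst (λ b → 𝟙 b + crossDegree G inside v ≡ 2) v-inside (inside+crossDegree≡2 v))

  outsideNeighbour : ∀ v → inside v ≡ true → Σ (Fin n) λ u → adj G v u ≡ true × inside u ≡ false
  outsideNeighbour v v-inside
    with ∑-𝟙≡1⇒unique (λ u → adj G v u ∧ (inside v xor inside u)) (crossDegree≡1 v v-inside)
  ... | u , vu-crosses , _ rewrite v-inside with adj G v u in vu | inside u in u-outside
  ...   | true | false = u , vu , u-outside

  loneOutside⇒hub : outsideCount ≡ 1 → Σ (Fin n) λ c → ∀ v → v ≢ c → adj G c v ≡ true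
  loneOutside⇒hub one with ∑-𝟙≡1⇒unique (λ v → not (inside v)) one
  ... | c , _ , only-c = c , λ v v≢c → adj-flip G (adjacent v v≢c)
    where
    adjacent : ∀ v → v ≢ c → adj G v c ≡ true
    adjacent v v≢c with inside v in v-inside
    ... | false = ⊥-elim (v≢c (only-c v (cong not v-inside)))
    ... | true with outsideNeighbour v v-inside
    ...   | u , vu , u-outside = subst (λ w → adj G v w ≡ true) (only-c u (cong not u-outside)) vu

mainTheorem1 : (n : ℕ) → 1 ≤ n → (G : SimpleGraph n) → (D : SVertex G → Bool)
    → IsExactDoublyDominatingS G D
    → (countOriginal G D ≤ n ∸ 1)
      × (countOriginal G D ≡ n ∸ 1 ⇔ (Isomorphic G P3 ⊎ Isomorphic G C3))
mainTheorem1 n 1≤n G D exact =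
  subst (_≤ n ∸ 1) (sym countOriginal≡insideCount) (a≤n∸1 partition balance 1≤n) ,
  mk⇔ tight⇒P3⊎C3 P3⊎C3⇒tight
  where
  open ExactDoubleDomination G D exact

  partition : insideCount + outsideCount ≡ n
  partition = insideCount+outsideCount≡n

  balance : insideCount ≡ 2 * outsideCount
  balance = insideCount≡2*outsideCount

  tight⇒P3⊎C3 : countOriginal G D ≡ n ∸ 1 → Isomorphic G P3 ⊎ Isomorphic G C3
  tight⇒P3⊎C3 tight = hub⇒P3⊎C3 G (b≡1⇒n≡3 partition balance lone) (proj₁ hub) (proj₂ hub)
    where
    lone : outsideCount ≡ 1
    lone = a≡n∸1⇒b≡1 partition 1≤n (trans (sym countOriginal≡insideCount) tight)
    hub : Σ (Fin n) λ c → ∀ v → v ≢ c → adj G c v ≡ true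
    hub = loneOutside⇒hub lone

  P3⊎C3⇒tight : Isomorphic G P3 ⊎ Isomorphic G C3 → countOriginal G D ≡ n ∸ 1
  P3⊎C3⇒tight iso =
    trans countOriginal≡insideCount
          (n≡3⇒a≡n∸1 partition balance (Sum.[ ↔⇒≡ ∘ proj₁ , ↔⇒≡ ∘ proj₁ ] iso))
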